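{- There exist diameter-2-critical graphs $G_1, G_2, \dots$ with $n_j := |V(G_j)| \to \infty$ such that the average edge-degree $\overline{d(e)}$ of $G_j$ satisfies \[ \overline{d(e)} \ \ge\ \left(\tfrac{10}{9} - \varepsilon_j\right) n_j \] for some sequence $\varepsilon_j \to 0$. In other words, there is an infinite family of diameter-2-critical graphs with $\overline{d(e)} \ge (\tfrac{10}{9}-o(1))\,n$, where $n$ is the number of vertices and $o(1)\to 0$ as $n\to\infty$.
   Context: All graphs are finite and simple. For vertices $x,y$ of a graph $G$, $d_G(x,y)$ is the length (number of edges) of a shortest $(x,y)$-path, which is $\infty$ if no such path exists. The diameter of $G$ is $\max_{x,y} d_G(x,y)$. A graph $G$ is diameter-critical if for every edge $e$, the graph $G-e$ has strictly larger diameter than $G$; it is diameter-$k$-critical if in addition its diameter equals $k$. For an edge $e=uv$, its edge-degree is $d(e)=d_u+d_v$ (sum of the degrees of its endpoints), and $\overline{d(e)}$ denotes the average of $d(e)$ over all edges; equivalently $\overline{d(e)} = \frac{1}{m}\sum_{v\in V(G)} d_v^2$ where $m$ is the number of edges. -}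

module Defs where

open import Data.Nat using (ℕ; zero; suc; _+_; _*_; _≤_; _<_; _<ᵇ_)
open import Data.Fin using (Fin; toℕ)
open import Data.Fin.Properties using (_≟_)
open import Data.Bool using (Bool; true; false; if_then_else_; _∧_; _∨_; not)
open import Data.List using (List; map; allFin)
open import Data.Nat.ListAction using (sum)
open import Data.Product using (_×_; ∃-syntax; Σ-syntax)
open import Data.Integer using (+_)
open import Data.Rational using (ℚ; _/_; 0ℚ)
open import Relation.Binary.PropositionalEquality using (_≡_)
open import Relation.Nullary using (¬_; does)

Graph : ℕ → Set
Graph n = Fin n → Fin n → Bool

IsSimple : ∀ {n} → Graph n → Set
IsSimple {n} G = (∀ (i j : Fin n) → G i j ≡ G j i) × (∀ (i : Fin n) → G i i ≡ false)

data Walk {n : ℕ} (G : Graph n) : ℕ → Fin n → Fin n → Set where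
  here : ∀ {x} → Walk G zero x x
  step : ∀ {k x y z} → G x y ≡ true → Walk G k y z → Walk G (suc k) x z

-- d_G(x,y) ≤ k  (a shortest path has length ≤ k iff some walk of length ≤ k exists)
DistLe : ∀ {n} → Graph n → ℕ → Fin n → Fin n → Set
DistLe G k x y = ∃[ l ] (l ≤ k × Walk G l x y)

DiamLe : ∀ {n} → Graph n → ℕ → Set
DiamLe {n} G k = ∀ (x y : Fin n) → DistLe G k x y

HasDiameter : ∀ {n} → Graph n → ℕ → Set
HasDiameter G k = DiamLe G k × (∀ j → j < k → ¬ DiamLe G j)

removeEdge : ∀ {n} → Graph n → Fin n → Fin n → Graph n
removeEdge G u v i j =
  if (does (i ≟ u) ∧ does (j ≟ v)) ∨ (does (i ≟ v) ∧ does (j ≟ u)) then false else G i j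

-- diameter-k-critical: simple, diameter k, and deleting any edge makes the
-- diameter strictly larger than k (possibly infinite).
IsDiameterCritical : ∀ {n} → Graph n → ℕ → Set
IsDiameterCritical {n} G k =
  IsSimple G × HasDiameter G k ×
  (∀ (u v : Fin n) → G u v ≡ true → ¬ DiamLe (removeEdge G u v) k)

indicator : Bool → ℕ
indicator true = 1
indicator false = 0

degree : ∀ {n} → Graph n → Fin n → ℕ
degree {n} G i = sum (map (λ j → indicator (G i j)) (allFin n))

sumOverEdges : ∀ {n} → Graph n → (Fin n → Fin n → ℕ) → ℕ
sumOverEdges {n} G f =
  sum (map (λ i → sum (map (λ j → if G i j ∧ (toℕ i <ᵇ toℕ j) then f i j else 0)
                           (allFin n)))
           (allFin n))

edgeCount : ∀ {n} → Graph n → ℕ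
edgeCount G = sumOverEdges G (λ _ _ → 1)

edgeDegreeSum : ∀ {n} → Graph n → ℕ
edgeDegreeSum G = sumOverEdges G (λ u v → degree G u + degree G v)

-- average edge-degree (convention: 0 for the edgeless graph)
avgEdgeDegree : ∀ {n} → Graph n → ℚ
avgEdgeDegree G with edgeCount G
... | zero = 0ℚ
... | suc k = (+ edgeDegreeSum G) / suc k

-- The graphs: take a clique a₁ … a_N, an independent set b₁ … b_N joined to every aᵢ, a pendant
-- xᵢ at each aᵢ, and two hubs w ∼ z with w adjacent to all xᵢ and z to all bᵢ; so n = 3N + 2.
-- Every pair of vertices has a common neighbour or is adjacent, so the diameter is 2.  Each edge is
-- critical: an edge aᵢaₖ or aᵢbₖ is the last edge of the only 2-path from xᵢ to its far endpoint, and
-- every other edge lies in no triangle, so deleting it leaves its endpoints at distance > 2.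
-- The degrees are 2N at aᵢ, N + 1 at bᵢ, w, z and 2 at xᵢ, so 2m = (3N + 2)(N + 1) and
-- Σ d(e) = Σ d_v² = 5N³ + O(N²); hence Σ d(e) / m = (10/3) N − O(1) ≥ (10/9 − 2/N) n.
module Submission where

open import Defs
open import Data.Nat using (ℕ)

module FinSums where

  open import Data.Nat using (ℕ; zero; suc; _+_; _*_)
  open import Data.Nat.Properties using (+-*-semiring; +-assoc; *-identityʳ)
  open import Data.Fin using (Fin; zero; suc; _↑ˡ_; _↑ʳ_)
  open import Data.Fin.Properties using (_≟_)
  open import Data.Bool using (not)
  open import Relation.Nullary using (does)
  open import Data.List using (map; allFin; tabulate)
  open import Data.List.Properties using (map-tabulate)
  open import Data.Nat.ListAction using (sum)
  open import Function using (_∘_; id)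
  open import Relation.Binary.PropositionalEquality

  open import Algebra.Properties.Semiring.Sum +-*-semiring public
    using (sum-syntax; ∑-distrib-+; ∑-comm; *-distribˡ-sum; sum-cong-≗; sum-replicate-zero)

  sum-map-allFin : ∀ n (f : Fin n → ℕ) → sum (map f (allFin n)) ≡ ∑[ i < n ] f i
  sum-map-allFin n f = trans (cong sum (map-tabulate id f)) (sum-tabulate n f)
    where
    sum-tabulate : ∀ n (f : Fin n → ℕ) → sum (tabulate f) ≡ ∑[ i < n ] f i
    sum-tabulate zero f = refl
    sum-tabulate (suc n) f = cong (f zero +_) (sum-tabulate n (f ∘ suc))

  ∑-const : ∀ n c → ∑[ i < n ] c ≡ n * c
  ∑-const zero c = refl
  ∑-const (suc n) c = cong (c +_) (∑-const n c)

  ∑-δ : ∀ {n} (i : Fin n) → ∑[ k < n ] indicator (does (i ≟ k)) ≡ 1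
  ∑-δ {suc n} zero = cong suc (sum-replicate-zero n)
  ∑-δ (suc i) = ∑-δ i

  ∑-δᶜ : ∀ {n} (i : Fin (suc n)) → ∑[ k < suc n ] indicator (not (does (i ≟ k))) ≡ n
  ∑-δᶜ {n} zero = trans (∑-const n 1) (*-identityʳ n)
  ∑-δᶜ {suc n} (suc i) = cong suc (∑-δᶜ i)

  ∑-split : ∀ m k (f : Fin (m + k) → ℕ) →
            ∑[ i < m + k ] f i ≡ ∑[ i < m ] f (i ↑ˡ k) + ∑[ i < k ] f (m ↑ʳ i)
  ∑-split zero k f = refl
  ∑-split (suc m) k f = trans (cong (f zero +_) (∑-split m k (f ∘ suc))) (sym (+-assoc (f zero) _ _))

module EdgeSums where

  open FinSums
  open import Data.Nat using (ℕ; _+_; _*_; _<_; _≤_; _<ᵇ_)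
  open import Data.Nat.Properties
    using (+-comm; +-identityʳ; *-identityʳ; *-zeroʳ; *-cancelˡ-≡; <ᵇ⇒<; <⇒<ᵇ; <-asym; ≮⇒≥; ≤-antisym)
  open import Data.Fin using (Fin; toℕ)
  open import Data.Fin.Properties using (toℕ-injective)
  open import Data.Bool using (true; false; if_then_else_; _∧_; T)
  open import Data.Product using (proj₁; proj₂)
  open import Data.Unit using (tt)
  open import Relation.Binary.PropositionalEquality
  open import Relation.Nullary using (contradiction)

  private
    <ᵇ≡true⇒< : ∀ m k → (m <ᵇ k) ≡ true → m < k
    <ᵇ≡true⇒< m k m<k = <ᵇ⇒< m k (subst T (sym m<k) tt)

    <ᵇ≡false⇒≥ : ∀ m k → (m <ᵇ k) ≡ false → k ≤ m
    <ᵇ≡false⇒≥ m k m≮k = ≮⇒≥ λ m<k → subst T m≮k (<⇒<ᵇ m<k)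

  degree≡∑indicator : ∀ {n} (G : Graph n) i → degree G i ≡ ∑[ j < n ] indicator (G i j)
  degree≡∑indicator {n} G i = sum-map-allFin n _

  module _ {n} (G : Graph n) (simple : IsSimple G) where

    private
      symmetric : ∀ i j → G i j ≡ G j i
      symmetric = proj₁ simple

      loopless : ∀ i → G i i ≡ false
      loopless = proj₂ simple

    incident : (Fin n → Fin n → ℕ) → Fin n → Fin n → ℕ
    incident F i j = if G i j then F i j else 0

    forward : (Fin n → Fin n → ℕ) → Fin n → Fin n → ℕ
    forward F i j = if G i j ∧ (toℕ i <ᵇ toℕ j) then F i j else 0

    incident≡forward+backward : (F : Fin n → Fin n → ℕ) → (∀ i j → F i j ≡ F j i) →
                                ∀ i j → incident F i j ≡ forward F i j + forward F j i
    incident≡forward+backward F F-sym i j rewrite symmetric j i with G i j in gij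
    ... | false = refl
    ... | true with toℕ i <ᵇ toℕ j in i<j | toℕ j <ᵇ toℕ i in j<i
    ...   | true  | true  = contradiction (<ᵇ≡true⇒< _ _ j<i) (<-asym (<ᵇ≡true⇒< (toℕ i) (toℕ j) i<j))
    ...   | true  | false = sym (+-identityʳ (F i j))
    ...   | false | true  = F-sym i j
    ...   | false | false = contradiction (trans (sym gij) (subst (λ k → G i k ≡ false) i≡j (loopless i))) λ ()
      where
      i≡j : i ≡ j
      i≡j = toℕ-injective
              (≤-antisym (<ᵇ≡false⇒≥ (toℕ j) (toℕ i) j<i) (<ᵇ≡false⇒≥ (toℕ i) (toℕ j) i<j))

    2*sumOverEdges≡∑∑incident : (F : Fin n → Fin n → ℕ) → (∀ i j → F i j ≡ F j i) →
                                2 * sumOverEdges G F ≡ ∑[ i < n ] ∑[ j < n ] incident F i j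
    2*sumOverEdges≡∑∑incident F F-sym = begin
      2 * sumOverEdges G F
        ≡⟨ cong (2 *_) (trans (sum-map-allFin n _) (sum-cong-≗ {n} λ i → sum-map-allFin n _)) ⟩
      2 * S                                      ≡⟨ cong (S +_) (+-identityʳ S) ⟩
      S + S                                      ≡⟨ cong (S +_) (∑-comm (forward F)) ⟩
      S + ∑[ i < n ] ∑[ j < n ] forward F j i    ≡⟨ sym (∑-distrib-+ (λ i → ∑[ j < n ] forward F i j) _) ⟩
      ∑[ i < n ] (∑[ j < n ] forward F i j + ∑[ j < n ] forward F j i)
        ≡⟨ sum-cong-≗ (λ i → sym (∑-distrib-+ (forward F i) (λ j → forward F j i))) ⟩
      ∑[ i < n ] ∑[ j < n ] (forward F i j + forward F j i)
        ≡⟨ sum-cong-≗ (λ i → sum-cong-≗ λ j → sym (incident≡forward+backward F F-sym i j)) ⟩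
      ∑[ i < n ] ∑[ j < n ] incident F i j       ∎
      where
      open ≡-Reasoning
      S : ℕ
      S = ∑[ i < n ] ∑[ j < n ] forward F i j

    handshake : 2 * edgeCount G ≡ ∑[ i < n ] degree G i
    handshake = trans (2*sumOverEdges≡∑∑incident (λ _ _ → 1) (λ _ _ → refl)) (sum-cong-≗ {n} λ i →
      trans (sum-cong-≗ {n} λ j → if-1-0 (G i j)) (sym (degree≡∑indicator G i)))
      where
      if-1-0 : ∀ b → (if b then 1 else 0) ≡ indicator b
      if-1-0 true = refl
      if-1-0 false = refl

    sumOverEdges-endpoints : (f : Fin n → ℕ) →
                             sumOverEdges G (λ u v → f u + f v) ≡ ∑[ i < n ] (f i * degree G i)
    sumOverEdges-endpoints f = *-cancelˡ-≡ _ _ 2 (begin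
      2 * sumOverEdges G (λ u v → f u + f v)
        ≡⟨ 2*sumOverEdges≡∑∑incident (λ u v → f u + f v) (λ u v → +-comm (f u) (f v)) ⟩
      ∑[ i < n ] ∑[ j < n ] incident (λ u v → f u + f v) i j
        ≡⟨ sum-cong-≗ {n} (λ i → sum-cong-≗ {n} λ j → incident-endpoints i j) ⟩
      ∑[ i < n ] ∑[ j < n ] (f i * indicator (G i j) + f j * indicator (G j i))
        ≡⟨ sum-cong-≗ {n} (λ i → ∑-distrib-+ (λ j → f i * indicator (G i j)) _) ⟩
      ∑[ i < n ] (∑[ j < n ] (f i * indicator (G i j)) + ∑[ j < n ] (f j * indicator (G j i)))
        ≡⟨ ∑-distrib-+ (λ i → ∑[ j < n ] (f i * indicator (G i j))) _ ⟩
      H + ∑[ i < n ] ∑[ j < n ] (f j * indicator (G j i))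
        ≡⟨ cong (H +_) (∑-comm (λ i j → f j * indicator (G j i))) ⟩
      H + H                                   ≡⟨ cong (H +_) (sym (+-identityʳ H)) ⟩
      2 * H
        ≡⟨ cong (2 *_) (sum-cong-≗ {n} λ i →
             trans (sym (*-distribˡ-sum {n} (f i) _)) (cong (f i *_) (sym (degree≡∑indicator G i)))) ⟩
      2 * ∑[ i < n ] (f i * degree G i)         ∎)
      where
      open ≡-Reasoning
      H : ℕ
      H = ∑[ i < n ] ∑[ j < n ] (f i * indicator (G i j))
      incident-endpoints : ∀ i j →
                           incident (λ u v → f u + f v) i j ≡ f i * indicator (G i j) + f j * indicator (G j i)
      incident-endpoints i j rewrite symmetric j i with G i j
      ... | true = sym (cong₂ _+_ (*-identityʳ (f i)) (*-identityʳ (f j)))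
      ... | false = sym (cong₂ _+_ (*-zeroʳ (f i)) (*-zeroʳ (f j)))

    edgeDegreeSum≡∑degree² : edgeDegreeSum G ≡ ∑[ i < n ] (degree G i * degree G i)
    edgeDegreeSum≡∑degree² = sumOverEdges-endpoints (degree G)


module Distance where

  open import Data.Nat using (ℕ; suc; _<_; z≤n; s≤s)
  open import Data.Nat.Properties using (≤-refl; ≤-trans)
  open import Data.Fin.Properties using (_≟_)
  open import Data.Bool using (Bool; true; false; _∧_; _∨_)
  open import Data.Sum using (_⊎_; inj₁; inj₂)
  open import Data.Empty using (⊥-elim)
  open import Data.Product using (_,_)
  open import Relation.Binary.PropositionalEquality
  open import Relation.Nullary using (¬_; does; contradiction)
  open import Relation.Nullary.Decidable using (dec-true)

  true≢false : true ≢ false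
  true≢false ()

  data Within2 {A : Set} (R : A → A → Bool) (x y : A) : Set where
    equal    : x ≡ y → Within2 R x y
    adjacent : R x y ≡ true → Within2 R x y
    common   : ∀ z → R x z ≡ true → R z y ≡ true → Within2 R x y

  within2-sym : ∀ {A : Set} {R : A → A → Bool} → (∀ x y → R x y ≡ R y x) →
                ∀ {x y} → Within2 R x y → Within2 R y x
  within2-sym R-sym (equal x≡y) = equal (sym x≡y)
  within2-sym R-sym (adjacent x∼y) = adjacent (trans (R-sym _ _) x∼y)
  within2-sym R-sym (common z x∼z z∼y) = common z (trans (R-sym _ _) z∼y) (trans (R-sym _ _) x∼z)

  private variable
    n : ℕ
    G : Graph n

  within2⇒distLe2 : ∀ {x y} → Within2 G x y → DistLe G 2 x y
  within2⇒distLe2 (equal refl) = 0 , z≤n , here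
  within2⇒distLe2 (adjacent e) = 1 , s≤s z≤n , step e here
  within2⇒distLe2 (common z e₁ e₂) = 2 , ≤-refl , step e₁ (step e₂ here)

  distLe2⇒within2 : ∀ {x y} → DistLe G 2 x y → Within2 G x y
  distLe2⇒within2 (0 , _ , here) = equal refl
  distLe2⇒within2 (1 , _ , step e here) = adjacent e
  distLe2⇒within2 (2 , _ , step e₁ (step e₂ here)) = common _ e₁ e₂
  distLe2⇒within2 (suc (suc (suc _)) , s≤s (s≤s ()) , _)

  ¬diamLe<2 : ∀ {x y} → x ≢ y → G x y ≡ false → ∀ l → l < 2 → ¬ DiamLe G l
  ¬diamLe<2 {x = x} {y = y} x≢y x≁y l l<2 D with D x y
  ... | 0 , _ , here = x≢y refl
  ... | 1 , _ , step x∼y here = true≢false (trans (sym x∼y) x≁y)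
  ... | suc (suc _) , l′≤l , _ = contradiction (≤-trans (s≤s l′≤l) l<2) λ { (s≤s (s≤s ())) }

  removeEdge-⊆ : ∀ (G : Graph n) u v i j → removeEdge G u v i j ≡ true → G i j ≡ true
  removeEdge-⊆ G u v i j e with (does (i ≟ u) ∧ does (j ≟ v)) ∨ (does (i ≟ v) ∧ does (j ≟ u))
  ... | false = e

  removeEdge-nonedge : ∀ (G : Graph n) u v i j → G i j ≡ false → removeEdge G u v i j ≡ false
  removeEdge-nonedge G u v i j i≁j with removeEdge G u v i j in e
  ... | false = refl
  ... | true = ⊥-elim (true≢false (trans (sym (removeEdge-⊆ G u v i j e)) i≁j))

  removeEdge-deletes : ∀ (G : Graph n) u v → removeEdge G u v u v ≡ false
  removeEdge-deletes G u v rewrite dec-true (u ≟ u) refl | dec-true (v ≟ v) refl = refl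

  removeEdge-critical : ∀ {u v p q} → p ≢ q → removeEdge G u v p q ≡ false →
                        (∀ w → G p w ≡ true → G w q ≡ true →
                               removeEdge G u v p w ≡ false ⊎ removeEdge G u v w q ≡ false) →
                        ¬ DiamLe (removeEdge G u v) 2
  removeEdge-critical {G = G} {u} {v} {p} {q} p≢q p≁q through D with distLe2⇒within2 (D p q)
  ... | equal p≡q = p≢q p≡q
  ... | adjacent p∼q = true≢false (trans (sym p∼q) p≁q)
  ... | common w p∼w w∼q with through w (removeEdge-⊆ G u v p w p∼w) (removeEdge-⊆ G u v w q w∼q)
  ...   | inj₁ p≁w = true≢false (trans (sym p∼w) p≁w)
  ...   | inj₂ w≁q = true≢false (trans (sym w∼q) w≁q)

module Construction (M : ℕ) where

  open FinSums
  open EdgeSums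
  open Distance
  open import Data.Nat using (zero; suc; _+_; _*_; _≤_; _<_; z≤n; s≤s)
  open import Data.Nat.Tactic.RingSolver using (solve-∀)
  open import Data.Nat.Properties using (+-identityʳ; m≤m+n; *-cancelˡ-≤; module ≤-Reasoning)
  open import Data.Fin using (Fin; zero; suc; splitAt; _↑ˡ_; _↑ʳ_)
  open import Data.Fin.Properties using (_≟_; splitAt-↑ˡ; splitAt-↑ʳ; splitAt⁻¹-↑ˡ; splitAt⁻¹-↑ʳ)
  open import Data.Bool using (Bool; true; false; not)
  open import Data.Sum using (inj₁; inj₂; [_,_]′)
  open import Data.Product using (_,_; proj₁)
  open import Data.Empty using (⊥; ⊥-elim)
  open import Function using (_∘_; mk⇔)
  open import Relation.Binary.PropositionalEquality
  open import Relation.Nullary using (¬_; does; yes; no)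
  open import Relation.Nullary.Decidable using (dec-true; dec-false; does-⇔)

  -- N ≥ 1: without any bᵢ and xᵢ the diameter would be 1.
  N : ℕ
  N = suc M

  data Vertex : Set where
    A B X : Fin N → Vertex
    W Z   : Vertex

  infix 5 _∼_

  _∼_ : Vertex → Vertex → Bool
  A i ∼ A k = not (does (i ≟ k))
  A i ∼ X k = does (i ≟ k)
  X k ∼ A i = does (k ≟ i)
  A _ ∼ B _ = true
  B _ ∼ A _ = true
  B _ ∼ Z   = true
  Z   ∼ B _ = true
  X _ ∼ W   = true
  W   ∼ X _ = true
  W   ∼ Z   = true
  Z   ∼ W   = true
  _   ∼ _   = false

  private
    ≟-sym : ∀ {n} (i k : Fin n) → does (i ≟ k) ≡ does (k ≟ i)
    ≟-sym i k = does-⇔ (mk⇔ sym sym) (i ≟ k) (k ≟ i)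

    ≟-true⇒≡ : ∀ {n} (i k : Fin n) → does (i ≟ k) ≡ true → i ≡ k
    ≟-true⇒≡ i k e with i ≟ k
    ... | yes i≡k = i≡k

  ∼-sym : ∀ (s t : Vertex) → (s ∼ t) ≡ (t ∼ s)
  ∼-sym (A i) (A k) = cong not (≟-sym i k)
  ∼-sym (A i) (X k) = ≟-sym i k
  ∼-sym (X k) (A i) = ≟-sym k i
  ∼-sym (A _) (B _) = refl
  ∼-sym (A _) W     = refl
  ∼-sym (A _) Z     = refl
  ∼-sym (B _) (A _) = refl
  ∼-sym (B _) (B _) = refl
  ∼-sym (B _) (X _) = refl
  ∼-sym (B _) W     = refl
  ∼-sym (B _) Z     = refl
  ∼-sym (X _) (B _) = refl
  ∼-sym (X _) (X _) = refl
  ∼-sym (X _) W     = refl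
  ∼-sym (X _) Z     = refl
  ∼-sym W     (A _) = refl
  ∼-sym W     (B _) = refl
  ∼-sym W     (X _) = refl
  ∼-sym W     W     = refl
  ∼-sym W     Z     = refl
  ∼-sym Z     (A _) = refl
  ∼-sym Z     (B _) = refl
  ∼-sym Z     (X _) = refl
  ∼-sym Z     W     = refl
  ∼-sym Z     Z     = refl

  ∼-irrefl : ∀ (s : Vertex) → (s ∼ s) ≡ false
  ∼-irrefl (A i) = cong not (dec-true (i ≟ i) refl)
  ∼-irrefl (B _) = refl
  ∼-irrefl (X _) = refl
  ∼-irrefl W     = refl
  ∼-irrefl Z     = refl

  size : ℕ
  size = N + (N + (N + 2))

  decode : Fin size → Vertex
  decode = [ A , [ B , [ X , hub ]′ ∘ splitAt N ]′ ∘ splitAt N ]′ ∘ splitAt N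
    where
    hub : Fin 2 → Vertex
    hub zero = W
    hub (suc zero) = Z

  encode : Vertex → Fin size
  encode (A i) = i ↑ˡ (N + (N + 2))
  encode (B i) = N ↑ʳ (i ↑ˡ (N + 2))
  encode (X i) = N ↑ʳ (N ↑ʳ (i ↑ˡ 2))
  encode W     = N ↑ʳ (N ↑ʳ (N ↑ʳ zero))
  encode Z     = N ↑ʳ (N ↑ʳ (N ↑ʳ suc zero))

  decode-encode : ∀ (s : Vertex) → decode (encode s) ≡ s
  decode-encode (A i) rewrite splitAt-↑ˡ N i (N + (N + 2)) = refl
  decode-encode (B i) rewrite splitAt-↑ʳ N (N + (N + 2)) (i ↑ˡ (N + 2)) | splitAt-↑ˡ N i (N + 2) = refl
  decode-encode (X i) rewrite splitAt-↑ʳ N (N + (N + 2)) (N ↑ʳ (i ↑ˡ 2)) | splitAt-↑ʳ N (N + 2) (i ↑ˡ 2)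
                                | splitAt-↑ˡ N i 2 = refl
  decode-encode W rewrite splitAt-↑ʳ N (N + (N + 2)) (N ↑ʳ (N ↑ʳ zero)) | splitAt-↑ʳ N (N + 2) (N ↑ʳ zero)
                            | splitAt-↑ʳ N 2 (zero {1}) = refl
  decode-encode Z rewrite splitAt-↑ʳ N (N + (N + 2)) (N ↑ʳ (N ↑ʳ suc zero)) | splitAt-↑ʳ N (N + 2) (N ↑ʳ suc zero)
                            | splitAt-↑ʳ N 2 (suc (zero {0})) = refl

  private
    splitAt⁻¹-↑ʳ² : ∀ {i : Fin size} {r t t′} → splitAt N i ≡ inj₂ r → splitAt N r ≡ inj₂ t → t′ ≡ t →
            N ↑ʳ (N ↑ʳ t′) ≡ i
    splitAt⁻¹-↑ʳ² eq₁ eq₂ t′≡t =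
      trans (cong (N ↑ʳ_) (trans (cong (N ↑ʳ_) t′≡t) (splitAt⁻¹-↑ʳ eq₂))) (splitAt⁻¹-↑ʳ eq₁)

  encode-decode : ∀ (i : Fin size) → encode (decode i) ≡ i
  encode-decode i with splitAt N i in eq₁
  ... | inj₁ _ = splitAt⁻¹-↑ˡ eq₁
  ... | inj₂ r with splitAt N r in eq₂
  ...   | inj₁ _ = trans (cong (N ↑ʳ_) (splitAt⁻¹-↑ˡ eq₂)) (splitAt⁻¹-↑ʳ eq₁)
  ...   | inj₂ t with splitAt N t in eq₃
  ...     | inj₁ _          = splitAt⁻¹-↑ʳ² eq₁ eq₂ (splitAt⁻¹-↑ˡ eq₃)
  ...     | inj₂ zero       = splitAt⁻¹-↑ʳ² eq₁ eq₂ (splitAt⁻¹-↑ʳ eq₃)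
  ...     | inj₂ (suc zero) = splitAt⁻¹-↑ʳ² eq₁ eq₂ (splitAt⁻¹-↑ʳ eq₃)

  within2 : ∀ s t → Within2 _∼_ s t
  within2 (A i) (A k) with i ≟ k
  ... | yes refl = equal refl
  ... | no i≢k   = adjacent (cong not (dec-false (i ≟ k) i≢k))
  within2 (A _) (B _) = adjacent refl
  within2 (A i) (X k) with i ≟ k
  ... | yes refl = adjacent (dec-true (i ≟ i) refl)
  ... | no i≢k   = common (A k) (cong not (dec-false (i ≟ k) i≢k)) (dec-true (k ≟ k) refl)
  within2 (A i) W     = common (X i) (dec-true (i ≟ i) refl) refl
  within2 (A i) Z     = common (B i) refl refl
  within2 (B j) (A i) = within2-sym ∼-sym (within2 (A i) (B j))
  within2 (B j) (B _) = common (A j) refl refl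
  within2 (B _) (X i) = common (A i) refl (dec-true (i ≟ i) refl)
  within2 (B _) W     = common Z refl refl
  within2 (B _) Z     = adjacent refl
  within2 (X k) (A i) = within2-sym ∼-sym (within2 (A i) (X k))
  within2 (X k) (B j) = within2-sym ∼-sym (within2 (B j) (X k))
  within2 (X _) (X _) = common W refl refl
  within2 (X _) W     = adjacent refl
  within2 (X _) Z     = common W refl refl
  within2 W     (A i) = within2-sym ∼-sym (within2 (A i) W)
  within2 W     (B j) = within2-sym ∼-sym (within2 (B j) W)
  within2 W     (X _) = adjacent refl
  within2 W     W     = equal refl
  within2 W     Z     = adjacent refl
  within2 Z     (A i) = within2-sym ∼-sym (within2 (A i) Z)
  within2 Z     (B _) = adjacent refl
  within2 Z     (X _) = common W refl refl
  within2 Z     W     = adjacent refl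
  within2 Z     Z     = equal refl

  graph : Graph size
  graph i j = decode i ∼ decode j

  graph-encode : ∀ s t → graph (encode s) (encode t) ≡ (s ∼ t)
  graph-encode s t = cong₂ _∼_ (decode-encode s) (decode-encode t)

  encode-injective : ∀ {s t} → encode s ≡ encode t → s ≡ t
  encode-injective {s} {t} e = trans (sym (decode-encode s)) (trans (cong decode e) (decode-encode t))

  decode-injective : ∀ {i j} → decode i ≡ decode j → i ≡ j
  decode-injective {i} {j} e = trans (sym (encode-decode i)) (trans (cong encode e) (encode-decode j))

  graph-simple : IsSimple graph
  graph-simple = (λ i j → ∼-sym (decode i) (decode j)) , (λ i → ∼-irrefl (decode i))

  graph-diameter : HasDiameter graph 2
  graph-diameter = (λ i j → within2⇒distLe2 (lift (within2 (decode i) (decode j))))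
                 , ¬diamLe<2 (λ e → B≢X (encode-injective e)) (graph-encode (B zero) (X zero))
    where
    lift : ∀ {i j} → Within2 _∼_ (decode i) (decode j) → Within2 graph i j
    lift (equal e) = equal (decode-injective e)
    lift (adjacent e) = adjacent e
    lift {i} {j} (common v e₁ e₂) =
      common (encode v) (subst (λ u → decode i ∼ u ≡ true) (sym (decode-encode v)) e₁)
                        (subst (λ u → u ∼ decode j ≡ true) (sym (decode-encode v)) e₂)
    B≢X : B zero ≢ X zero
    B≢X ()

  NoCommonNeighbour : Vertex → Vertex → Set
  NoCommonNeighbour s t = ∀ v → s ∼ v ≡ true → v ∼ t ≡ true → ⊥

  noCommonNeighbour-sym : ∀ {s t} → NoCommonNeighbour s t → NoCommonNeighbour t s
  noCommonNeighbour-sym {s} {t} tf v t∼v v∼s = tf v (trans (∼-sym s v) v∼s) (trans (∼-sym v t) t∼v)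

  AX-noCommonNeighbour : ∀ i → NoCommonNeighbour (A i) (X i)
  AX-noCommonNeighbour i (A l) Ai∼Al Al∼Xi with ≟-true⇒≡ l i Al∼Xi
  ... | refl = true≢false (trans (sym Ai∼Al) (∼-irrefl (A i)))
  AX-noCommonNeighbour i (B _) _ ()
  AX-noCommonNeighbour i (X _) _ ()
  AX-noCommonNeighbour i W ()
  AX-noCommonNeighbour i Z ()

  BZ-noCommonNeighbour : ∀ j → NoCommonNeighbour (B j) Z
  BZ-noCommonNeighbour j (A _) _ ()
  BZ-noCommonNeighbour j (B _) ()
  BZ-noCommonNeighbour j (X _) ()
  BZ-noCommonNeighbour j W ()
  BZ-noCommonNeighbour j Z _ ()

  XW-noCommonNeighbour : ∀ k → NoCommonNeighbour (X k) W
  XW-noCommonNeighbour k (A _) _ ()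
  XW-noCommonNeighbour k (B _) ()
  XW-noCommonNeighbour k (X _) ()
  XW-noCommonNeighbour k W _ ()
  XW-noCommonNeighbour k Z ()

  WZ-noCommonNeighbour : NoCommonNeighbour W Z
  WZ-noCommonNeighbour (A _) ()
  WZ-noCommonNeighbour (B _) ()
  WZ-noCommonNeighbour (X _) _ ()
  WZ-noCommonNeighbour W ()
  WZ-noCommonNeighbour Z _ ()

  commonNeighbour-X≡A : ∀ i t → W ∼ t ≡ false → ∀ v → X i ∼ v ≡ true → v ∼ t ≡ true → v ≡ A i
  commonNeighbour-X≡A i t W≁t (A k) Xi∼Ak _ = cong A (sym (≟-true⇒≡ i k Xi∼Ak))
  commonNeighbour-X≡A i t W≁t W _ W∼t = ⊥-elim (true≢false (trans (sym W∼t) W≁t))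
  commonNeighbour-X≡A i t W≁t (B _) ()
  commonNeighbour-X≡A i t W≁t (X _) ()
  commonNeighbour-X≡A i t W≁t Z ()

  graph-encodeˡ : ∀ s j → graph (encode s) j ≡ (s ∼ decode j)
  graph-encodeˡ s j = cong (_∼ decode j) (decode-encode s)

  graph-encodeʳ : ∀ i t → graph i (encode t) ≡ (decode i ∼ t)
  graph-encodeʳ i t = cong (decode i ∼_) (decode-encode t)

  Critical : Fin size → Fin size → Set
  Critical u v = ¬ DiamLe (removeEdge graph u v) 2

  critical-noCommonNeighbour : ∀ s t → s ≢ t → NoCommonNeighbour s t → Critical (encode s) (encode t)
  critical-noCommonNeighbour s t s≢t noCommon =
    removeEdge-critical (λ e → s≢t (encode-injective e)) (removeEdge-deletes graph (encode s) (encode t))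
      λ w s∼w w∼t → ⊥-elim (noCommon (decode w) (trans (sym (graph-encodeˡ s w)) s∼w)
                                                (trans (sym (graph-encodeʳ w t)) w∼t))

  graph-commonNeighbour-X≡A : ∀ i t → W ∼ t ≡ false →
                   ∀ w → graph (encode (X i)) w ≡ true → graph w (encode t) ≡ true → w ≡ encode (A i)
  graph-commonNeighbour-X≡A i t W≁t w Xi∼w w∼t =
    trans (sym (encode-decode w))
          (cong encode (commonNeighbour-X≡A i t W≁t (decode w) (trans (sym (graph-encodeˡ (X i) w)) Xi∼w)
                                                           (trans (sym (graph-encodeʳ w t)) w∼t)))

  critical-via-X : ∀ i t → X i ≢ t → X i ∼ t ≡ false → W ∼ t ≡ false →
                   Critical (encode (A i)) (encode t)
  critical-via-X i t Xi≢t Xi≁t W≁t =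
    removeEdge-critical (λ e → Xi≢t (encode-injective e))
      (removeEdge-nonedge graph (encode (A i)) (encode t) (encode (X i)) (encode t)
        (trans (graph-encode (X i) t) Xi≁t))
      λ w Xi∼w w∼t → inj₂ (subst (λ w → removeEdge graph (encode (A i)) (encode t) w (encode t) ≡ false)
                                 (sym (graph-commonNeighbour-X≡A i t W≁t w Xi∼w w∼t))
                                 (removeEdge-deletes graph (encode (A i)) (encode t)))

  critical-via-X′ : ∀ i t → X i ≢ t → X i ∼ t ≡ false → W ∼ t ≡ false →
                    Critical (encode t) (encode (A i))
  critical-via-X′ i t Xi≢t Xi≁t W≁t =
    removeEdge-critical (λ e → Xi≢t (sym (encode-injective e)))
      (removeEdge-nonedge graph (encode t) (encode (A i)) (encode t) (encode (X i))
        (trans (graph-encode t (X i)) (trans (∼-sym t (X i)) Xi≁t)))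
      λ w t∼w w∼Xi → inj₁ (subst (λ w → removeEdge graph (encode t) (encode (A i)) (encode t) w ≡ false)
                                 (sym (graph-commonNeighbour-X≡A i t W≁t w (trans (graph-sym (encode (X i)) w) w∼Xi)
                                                                (trans (graph-sym w (encode t)) t∼w)))
                                 (removeEdge-deletes graph (encode t) (encode (A i))))
    where
    graph-sym : ∀ i j → graph i j ≡ graph j i
    graph-sym = proj₁ graph-simple

  critical-encode : ∀ s t → s ∼ t ≡ true → Critical (encode s) (encode t)
  critical-encode (A i) (A k) Ai∼Ak = critical-via-X i (A k) (λ ()) (dec-false (i ≟ k) i≢k) refl
    where
    i≢k : i ≢ k
    i≢k refl = true≢false (trans (sym Ai∼Ak) (∼-irrefl (A i)))
  critical-encode (A i) (B j) _ = critical-via-X i (B j) (λ ()) refl refl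
  critical-encode (B j) (A i) _ = critical-via-X′ i (B j) (λ ()) refl refl
  critical-encode (A i) (X k) Ai∼Xk with ≟-true⇒≡ i k Ai∼Xk
  ... | refl = critical-noCommonNeighbour (A i) (X i) (λ ()) (AX-noCommonNeighbour i)
  critical-encode (X k) (A i) Xk∼Ai with ≟-true⇒≡ k i Xk∼Ai
  ... | refl = critical-noCommonNeighbour (X k) (A k) (λ ())
                 (noCommonNeighbour-sym (AX-noCommonNeighbour k))
  critical-encode (B j) Z     _ = critical-noCommonNeighbour (B j) Z (λ ()) (BZ-noCommonNeighbour j)
  critical-encode Z     (B j) _ = critical-noCommonNeighbour Z (B j) (λ ()) (noCommonNeighbour-sym (BZ-noCommonNeighbour j))
  critical-encode (X k) W     _ = critical-noCommonNeighbour (X k) W (λ ()) (XW-noCommonNeighbour k)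
  critical-encode W     (X k) _ = critical-noCommonNeighbour W (X k) (λ ()) (noCommonNeighbour-sym (XW-noCommonNeighbour k))
  critical-encode W     Z     _ = critical-noCommonNeighbour W Z (λ ()) WZ-noCommonNeighbour
  critical-encode Z     W     _ = critical-noCommonNeighbour Z W (λ ()) (noCommonNeighbour-sym WZ-noCommonNeighbour)
  critical-encode (A _) W     ()
  critical-encode (A _) Z     ()
  critical-encode (B _) (B _) ()
  critical-encode (B _) (X _) ()
  critical-encode (B _) W     ()
  critical-encode (X _) (B _) ()
  critical-encode (X _) (X _) ()
  critical-encode (X _) Z     ()
  critical-encode W     (A _) ()
  critical-encode W     (B _) ()
  critical-encode W     W     ()
  critical-encode Z     (A _) ()
  critical-encode Z     (X _) ()
  critical-encode Z     Z     ()

  graph-critical : ∀ u v → graph u v ≡ true → Critical u v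
  graph-critical u v u∼v =
    subst₂ Critical (encode-decode u) (encode-decode v) (critical-encode (decode u) (decode v) u∼v)

  graph-diameterCritical : IsDiameterCritical graph 2
  graph-diameterCritical = graph-simple , graph-diameter , graph-critical

  ∑-decode : ∀ (f : Vertex → ℕ) → ∑[ i < size ] f (decode i) ≡
             ∑[ i < N ] f (A i) + (∑[ i < N ] f (B i) + (∑[ i < N ] f (X i) + (f W + f Z)))
  ∑-decode f = begin
    ∑[ i < size ] f (decode i)
      ≡⟨ ∑-split N _ (f ∘ decode) ⟩
    ΣA + ∑[ i < N + (N + 2) ] f (decode (N ↑ʳ i))
      ≡⟨ cong (ΣA +_) (∑-split N _ λ i → f (decode (N ↑ʳ i))) ⟩
    ΣA + (ΣB + ∑[ i < N + 2 ] f (decode (N ↑ʳ (N ↑ʳ i))))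
      ≡⟨ cong (λ σ → ΣA + (ΣB + σ)) (∑-split N 2 λ i → f (decode (N ↑ʳ (N ↑ʳ i)))) ⟩
    ΣA + (ΣB + (ΣX + (f (decode (encode W)) + (f (decode (encode Z)) + 0))))
      ≡⟨ cong₂ _+_ (∑-cong A) (cong₂ _+_ (∑-cong B) (cong₂ _+_ (∑-cong X)
           (cong₂ _+_ (cong f (decode-encode W)) (trans (+-identityʳ _) (cong f (decode-encode Z)))))) ⟩
    ∑[ i < N ] f (A i) + (∑[ i < N ] f (B i) + (∑[ i < N ] f (X i) + (f W + f Z))) ∎
    where
    open ≡-Reasoning
    ΣA ΣB ΣX : ℕ
    ΣA = ∑[ i < N ] f (decode (encode (A i)))
    ΣB = ∑[ i < N ] f (decode (encode (B i)))
    ΣX = ∑[ i < N ] f (decode (encode (X i)))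
    ∑-cong : (V : Fin N → Vertex) → ∑[ i < N ] f (decode (encode (V i))) ≡ ∑[ i < N ] f (V i)
    ∑-cong V = sum-cong-≗ {N} λ i → cong f (decode-encode (V i))

  ∑-decode-classes : ∀ (f : Vertex → ℕ) {α β ξ} →
                     (∀ i → f (A i) ≡ α) → (∀ i → f (B i) ≡ β) → (∀ i → f (X i) ≡ ξ) →
                     ∑[ i < size ] f (decode i) ≡ N * α + (N * β + (N * ξ + (f W + f Z)))
  ∑-decode-classes f fA fB fX = trans (∑-decode f)
    (cong₂ _+_ (∑-constant fA) (cong₂ _+_ (∑-constant fB) (cong (_+ (f W + f Z)) (∑-constant fX))))
    where
    ∑-constant : ∀ {g : Fin N → ℕ} {c} → (∀ i → g i ≡ c) → ∑[ i < N ] g i ≡ N * c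
    ∑-constant g≡c = trans (sum-cong-≗ {N} g≡c) (∑-const N _)

  deg : Vertex → ℕ
  deg s = ∑[ j < size ] indicator (s ∼ decode j)

  deg-A : ∀ i → deg (A i) ≡ N + N
  deg-A i = trans (∑-decode (indicator ∘ (A i ∼_)))
    (trans (cong₂ _+_ (∑-δᶜ i) (cong₂ _+_ (∑-const N 1) (cong (_+ 0) (∑-δ i)))) (arith M))
    where
    arith : ∀ M → M + (suc M * 1 + (1 + 0)) ≡ suc M + suc M
    arith = solve-∀

  deg-B : ∀ j → deg (B j) ≡ suc N
  deg-B j = trans (∑-decode (indicator ∘ (B j ∼_)))
    (trans (cong₂ _+_ (∑-const N 1) (cong₂ _+_ (sum-replicate-zero N) (cong (_+ 1) (sum-replicate-zero N))))
           (arith M))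
    where
    arith : ∀ M → suc M * 1 + (0 + (0 + 1)) ≡ suc (suc M)
    arith = solve-∀

  deg-X : ∀ k → deg (X k) ≡ 2
  deg-X k = trans (∑-decode (indicator ∘ (X k ∼_)))
    (cong₂ _+_ (∑-δ k) (cong₂ _+_ (sum-replicate-zero N) (cong (_+ 1) (sum-replicate-zero N))))

  deg-W : deg W ≡ suc N
  deg-W = trans (∑-decode (indicator ∘ (W ∼_)))
    (trans (cong₂ _+_ (sum-replicate-zero N) (cong₂ _+_ (sum-replicate-zero N) (cong (_+ 1) (∑-const N 1))))
           (arith M))
    where
    arith : ∀ M → 0 + (0 + (suc M * 1 + 1)) ≡ suc (suc M)
    arith = solve-∀

  deg-Z : deg Z ≡ suc N
  deg-Z = trans (∑-decode (indicator ∘ (Z ∼_)))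
    (trans (cong₂ _+_ (sum-replicate-zero N) (cong₂ _+_ (∑-const N 1) (cong (_+ 1) (sum-replicate-zero N))))
           (arith M))
    where
    arith : ∀ M → 0 + (suc M * 1 + (0 + 1)) ≡ suc (suc M)
    arith = solve-∀

  degree-graph : ∀ i → degree graph i ≡ deg (decode i)
  degree-graph = degree≡∑indicator graph

  edgeCount-graph : 2 * edgeCount graph ≡ (3 * N + 2) * (N + 1)
  edgeCount-graph = begin
    2 * edgeCount graph                                    ≡⟨ handshake graph graph-simple ⟩
    ∑[ i < size ] degree graph i                           ≡⟨ sum-cong-≗ {size} degree-graph ⟩
    ∑[ i < size ] deg (decode i)                           ≡⟨ ∑-decode-classes deg deg-A deg-B deg-X ⟩
    N * (N + N) + (N * suc N + (N * 2 + (deg W + deg Z)))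
      ≡⟨ cong (λ d → N * (N + N) + (N * suc N + (N * 2 + d))) (cong₂ _+_ deg-W deg-Z) ⟩
    N * (N + N) + (N * suc N + (N * 2 + (suc N + suc N)))  ≡⟨ arith N ⟩
    (3 * N + 2) * (N + 1)                                  ∎
    where
    open ≡-Reasoning
    arith : ∀ x → x * (x + x) + (x * suc x + (x * 2 + (suc x + suc x))) ≡ (3 * x + 2) * (x + 1)
    arith = solve-∀

  edgeDegreeSum-graph : edgeDegreeSum graph ≡ 5 * (N * N * N) + 4 * (N * N) + 9 * N + 2
  edgeDegreeSum-graph = begin
    edgeDegreeSum graph                                    ≡⟨ edgeDegreeSum≡∑degree² graph graph-simple ⟩
    ∑[ i < size ] (degree graph i * degree graph i)
      ≡⟨ sum-cong-≗ {size} (λ i → square (degree-graph i)) ⟩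
    ∑[ i < size ] (deg (decode i) * deg (decode i))
      ≡⟨ ∑-decode-classes (λ s → deg s * deg s) (square ∘ deg-A) (square ∘ deg-B) (square ∘ deg-X) ⟩
    N * ((N + N) * (N + N)) + (N * (suc N * suc N) + (N * (2 * 2) + (deg W * deg W + deg Z * deg Z)))
      ≡⟨ cong (λ d → N * ((N + N) * (N + N)) + (N * (suc N * suc N) + (N * (2 * 2) + d)))
              (cong₂ _+_ (square deg-W) (square deg-Z)) ⟩
    N * ((N + N) * (N + N)) + (N * (suc N * suc N) + (N * (2 * 2) + (suc N * suc N + suc N * suc N)))
      ≡⟨ arith N ⟩
    5 * (N * N * N) + 4 * (N * N) + 9 * N + 2              ∎
    where
    open ≡-Reasoning
    square : ∀ {x y} → x ≡ y → x * x ≡ y * y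
    square x≡y = cong₂ _*_ x≡y x≡y
    arith : ∀ x → x * ((x + x) * (x + x)) + (x * (suc x * suc x) + (x * (2 * 2) + (suc x * suc x + suc x * suc x)))
                  ≡ 5 * (x * x * x) + 4 * (x * x) + 9 * x + 2
    arith = solve-∀

  edgeCount-positive : 0 < edgeCount graph
  edgeCount-positive with edgeCount graph | edgeCount-graph
  ... | suc _ | _ = s≤s z≤n

  -- (10/9 − 2/N) · size ≤ edgeDegreeSum graph / edgeCount graph, cross-multiplied.
  edgeDegreeSum-bound : 10 * size * (edgeCount graph * N) ≤ (edgeDegreeSum graph * N + 2 * size * edgeCount graph) * 9
  edgeDegreeSum-bound = *-cancelˡ-≤ 2 (begin
    2 * (10 * size * (m * N))                        ≡⟨ arithˡ N m ⟩
    10 * size * N * (2 * m)                          ≡⟨ cong (10 * size * N *_) edgeCount-graph ⟩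
    10 * size * N * D                                ≤⟨ m≤m+n _ slack ⟩
    10 * size * N * D + slack                        ≡⟨ expand N ⟩
    18 * S * N + 18 * size * D
      ≡⟨ cong (λ d → 18 * S * N + 18 * size * d) (sym edgeCount-graph) ⟩
    18 * S * N + 18 * size * (2 * m)                 ≡⟨ arithʳ N S m ⟩
    2 * ((S * N + 2 * size * m) * 9)
      ≡⟨ cong (λ σ → 2 * ((σ * N + 2 * size * m) * 9)) (sym edgeDegreeSum-graph) ⟩
    2 * ((edgeDegreeSum graph * N + 2 * size * m) * 9) ∎)
    where
    open ≤-Reasoning
    m D S slack : ℕ
    m = edgeCount graph
    D = (3 * N + 2) * (N + 1)
    S = 5 * (N * N * N) + 4 * (N * N) + 9 * N + 2
    slack = 24 * (N * N * N) + 380 * (N * N) + 284 * N + 72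
    arithˡ : ∀ x y → 2 * (10 * (x + (x + (x + 2))) * (y * x)) ≡ 10 * (x + (x + (x + 2))) * x * (2 * y)
    arithˡ = solve-∀
    arithʳ : ∀ x s y → 18 * s * x + 18 * (x + (x + (x + 2))) * (2 * y)
                       ≡ 2 * ((s * x + 2 * (x + (x + (x + 2))) * y) * 9)
    arithʳ = solve-∀
    expand : ∀ x → 10 * (x + (x + (x + 2))) * x * ((3 * x + 2) * (x + 1))
                     + (24 * (x * x * x) + 380 * (x * x) + 284 * x + 72)
                   ≡ 18 * (5 * (x * x * x) + 4 * (x * x) + 9 * x + 2) * x
                     + 18 * (x + (x + (x + 2))) * ((3 * x + 2) * (x + 1))
    expand = solve-∀

module Fractions where

  open import Data.Nat as ℕ using (suc)
  import Data.Nat.Properties as ℕ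
  open import Data.Integer as ℤ using (+_; +[1+_]; -[1+_]; +≤+; +<+)
  import Data.Integer.Properties as ℤ
  open import Data.Rational using (mkℚ; 0ℚ; _/_; _+_; _*_; _-_; -_; _≤_; _<_; ∣_∣; *<*; toℚᵘ)
  open import Data.Rational.Properties
  import Data.Rational.Unnormalised as ℚᵘ
  import Data.Rational.Unnormalised.Properties as ℚᵘ
  open import Data.Product using (∃-syntax; _,_)
  open import Relation.Binary.PropositionalEquality

  private
    toℚᵘ-/ : ∀ a b → toℚᵘ (+ a / suc b) ℚᵘ.≃ ℚᵘ.mkℚᵘ (+ a) b
    toℚᵘ-/ a b = toℚᵘ-fromℚᵘ (ℚᵘ.mkℚᵘ (+ a) b)

  *≤*⇒/≤/ : ∀ a b c d → a ℕ.* suc d ℕ.≤ c ℕ.* suc b → + a / suc b ≤ + c / suc d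
  *≤*⇒/≤/ a b c d ad≤cb = toℚᵘ-cancel-≤
    (ℚᵘ.≤-respˡ-≃ (ℚᵘ.≃-sym (toℚᵘ-/ a b)) (ℚᵘ.≤-respʳ-≃ (ℚᵘ.≃-sym (toℚᵘ-/ c d))
      (ℚᵘ.*≤* (subst₂ ℤ._≤_ (ℤ.pos-* a (suc d)) (ℤ.pos-* c (suc b)) (+≤+ ad≤cb)))))

  /-*-/ : ∀ a b c d → (+ a / suc b) * (+ c / suc d) ≡ + (a ℕ.* c) / (suc b ℕ.* suc d)
  /-*-/ a b c d = toℚᵘ-injective (begin
    toℚᵘ ((+ a / suc b) * (+ c / suc d))               ≈⟨ toℚᵘ-homo-* (+ a / suc b) (+ c / suc d) ⟩
    toℚᵘ (+ a / suc b) ℚᵘ.* toℚᵘ (+ c / suc d)         ≈⟨ ℚᵘ.*-cong (toℚᵘ-/ a b) (toℚᵘ-/ c d) ⟩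
    ℚᵘ.mkℚᵘ (+ a ℤ.* + c) (ℕ.pred (suc b ℕ.* suc d))
      ≡⟨ cong (λ i → ℚᵘ.mkℚᵘ i _) (sym (ℤ.pos-* a c)) ⟩
    ℚᵘ.mkℚᵘ (+ (a ℕ.* c)) (ℕ.pred (suc b ℕ.* suc d))   ≈⟨ ℚᵘ.≃-sym (toℚᵘ-/ (a ℕ.* c) _) ⟩
    toℚᵘ (+ (a ℕ.* c) / (suc b ℕ.* suc d))             ∎)
    where open ℚᵘ.≃-Reasoning

  /-*-/1 : ∀ a b c → (+ a / suc b) * (+ c / 1) ≡ + (a ℕ.* c) / suc b
  /-*-/1 a b c = trans (/-*-/ a b c 0) (/-cong {p₁ = + (a ℕ.* c)} refl (ℕ.*-identityʳ (suc b)))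

  /-+-/ : ∀ a b c d → (+ a / suc b) + (+ c / suc d) ≡ + (a ℕ.* suc d ℕ.+ c ℕ.* suc b) / (suc b ℕ.* suc d)
  /-+-/ a b c d = toℚᵘ-injective (begin
    toℚᵘ ((+ a / suc b) + (+ c / suc d))               ≈⟨ toℚᵘ-homo-+ (+ a / suc b) (+ c / suc d) ⟩
    toℚᵘ (+ a / suc b) ℚᵘ.+ toℚᵘ (+ c / suc d)         ≈⟨ ℚᵘ.+-cong (toℚᵘ-/ a b) (toℚᵘ-/ c d) ⟩
    ℚᵘ.mkℚᵘ (+ a ℤ.* + suc d ℤ.+ + c ℤ.* + suc b) (ℕ.pred (suc b ℕ.* suc d))
      ≡⟨ cong (λ i → ℚᵘ.mkℚᵘ i _) (sym numerator) ⟩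
    ℚᵘ.mkℚᵘ (+ (a ℕ.* suc d ℕ.+ c ℕ.* suc b)) (ℕ.pred (suc b ℕ.* suc d))
      ≈⟨ ℚᵘ.≃-sym (toℚᵘ-/ (a ℕ.* suc d ℕ.+ c ℕ.* suc b) _) ⟩
    toℚᵘ (+ (a ℕ.* suc d ℕ.+ c ℕ.* suc b) / (suc b ℕ.* suc d)) ∎)
    where
    open ℚᵘ.≃-Reasoning
    numerator : + (a ℕ.* suc d ℕ.+ c ℕ.* suc b) ≡ + a ℤ.* + suc d ℤ.+ + c ℤ.* + suc b
    numerator = trans (ℤ.pos-+ (a ℕ.* suc d) (c ℕ.* suc b))
                      (cong₂ ℤ._+_ (ℤ.pos-* a (suc d)) (ℤ.pos-* c (suc b)))

  p*r≤q+e*r⇒[p-e]*r≤q : ∀ p e r q → p * r ≤ q + e * r → (p - e) * r ≤ q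
  p*r≤q+e*r⇒[p-e]*r≤q p e r q pr≤q+er = begin
    (p - e) * r          ≡⟨ trans (*-distribʳ-+ r p (- e)) (cong (_+_ (p * r)) (sym (neg-distribˡ-* e r))) ⟩
    p * r - e * r        ≤⟨ +-monoˡ-≤ (- (e * r)) pr≤q+er ⟩
    q + e * r - e * r    ≡⟨ +-assoc q (e * r) (- (e * r)) ⟩
    q + (e * r - e * r)  ≡⟨ trans (cong (_+_ q) (+-inverseʳ (e * r))) (+-identityʳ q) ⟩
    q                    ∎
    where open ≤-Reasoning

  [p/q-c/e]*n≤s/m : ∀ p q c e n s m →
                    p ℕ.* n ℕ.* (suc m ℕ.* suc e) ℕ.≤ (s ℕ.* suc e ℕ.+ c ℕ.* n ℕ.* suc m) ℕ.* suc q →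
                    ((+ p / suc q) - (+ c / suc e)) * (+ n / 1) ≤ + s / suc m
  [p/q-c/e]*n≤s/m p q c e n s m cross =
    p*r≤q+e*r⇒[p-e]*r≤q (+ p / suc q) (+ c / suc e) (+ n / 1) (+ s / suc m) (begin
      (+ p / suc q) * (+ n / 1)                                   ≡⟨ /-*-/1 p q n ⟩
      + (p ℕ.* n) / suc q
        ≤⟨ *≤*⇒/≤/ (p ℕ.* n) q (s ℕ.* suc e ℕ.+ c ℕ.* n ℕ.* suc m) (e ℕ.+ m ℕ.* suc e) cross ⟩
      + (s ℕ.* suc e ℕ.+ c ℕ.* n ℕ.* suc m) / (suc m ℕ.* suc e)   ≡⟨ sym (/-+-/ s m (c ℕ.* n) e) ⟩
      + s / suc m + + (c ℕ.* n) / suc e                           ≡⟨ cong (_+_ (+ s / suc m)) (sym (/-*-/1 c e n)) ⟩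
      + s / suc m + (+ c / suc e) * (+ n / 1)                     ∎)
    where open ≤-Reasoning

  avgEdgeDegree-≥ : ∀ {k} (G : Graph k) p q c e → 0 ℕ.< edgeCount G →
                    p ℕ.* k ℕ.* (edgeCount G ℕ.* suc e)
                      ℕ.≤ (edgeDegreeSum G ℕ.* suc e ℕ.+ c ℕ.* k ℕ.* edgeCount G) ℕ.* suc q →
                    ((+ p / suc q) - (+ c / suc e)) * (+ k / 1) ≤ avgEdgeDegree G
  avgEdgeDegree-≥ {k} G p q c e 0<m cross with edgeCount G | 0<m
  ... | suc m | _ = [p/q-c/e]*n≤s/m p q c e k (edgeDegreeSum G) m cross

  2/suc-vanishes : ∀ δ → 0ℚ < δ → ∃[ J ] ∀ j → J ℕ.≤ j → ∣ + 2 / suc j ∣ ≤ δ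
  2/suc-vanishes (mkℚ (+ 0) _ _) (*<* (+<+ ()))
  2/suc-vanishes (mkℚ -[1+ _ ] _ _) (*<* ())
  2/suc-vanishes δ@(mkℚ +[1+ a ] b _) _ = 2 ℕ.* suc b , λ j J≤j →
    subst₂ _≤_ (sym (0≤p⇒∣p∣≡p (nonNegative⁻¹ _ {{normalize-nonNeg 2 (suc j)}}))) (↥p/↧p≡p δ)
      (*≤*⇒/≤/ 2 j (suc a) b
        (ℕ.≤-trans J≤j (ℕ.≤-trans (ℕ.n≤1+n j) (ℕ.m≤m+n (suc j) (a ℕ.* suc j)))))

open import Data.Nat using (ℕ; _≤_; suc)
open import Data.Nat.Properties using (≤-trans; n≤1+n; m≤m+n)
open import Data.Integer using (+_)
open import Data.Rational using (ℚ; _/_; 0ℚ; _-_; _*_; _<_; ∣_∣) renaming (_≤_ to _≤ℚ_)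
open import Data.Product using (_×_; Σ-syntax; ∃-syntax; _,_)
open Construction using (size; graph; graph-diameterCritical; edgeCount-positive; edgeDegreeSum-bound)
open Fractions using (2/suc-vanishes; avgEdgeDegree-≥)

theorem1p3 : Σ[ n ∈ (ℕ → ℕ) ] Σ[ G ∈ ((j : ℕ) → Graph (n j)) ] Σ[ ε ∈ (ℕ → ℚ) ]
    ((∀ j → IsDiameterCritical (G j) 2)
    × (∀ N → ∃[ J ] (∀ j → J ≤ j → N ≤ n j))
    × (∀ δ → 0ℚ < δ → ∃[ J ] (∀ j → J ≤ j → ∣ ε j ∣ ≤ℚ δ))
    × (∀ j → ((+ 10 / 9) - ε j) * (+ n j / 1) ≤ℚ avgEdgeDegree (G j)))
theorem1p3 = size , graph , (λ j → + 2 / suc j) ,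
  ( graph-diameterCritical
  , (λ N → N , λ j N≤j → ≤-trans N≤j (≤-trans (n≤1+n j) (m≤m+n (suc j) _)))
  , 2/suc-vanishes
  , λ j → avgEdgeDegree-≥ (graph j) 10 8 2 j (edgeCount-positive j) (edgeDegreeSum-bound j) )
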